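{- Let $k\ge2$ and let $(a_i)_{i=1}^k$ and $(b_i)_{i=1}^k$ be sequences of positive integers with $a_1<a_2<\dots<a_k$, the $b_i$ pairwise distinct, $a_i\ge b_i$ for all $i$, and $a_{k-1}>b_k$. Suppose (straddling hypothesis) that whenever $a_i=b_i$, there exists $j\ne k-1$ with $b_j<a_i<a_j$. Let $(b_1^*,\dots,b_{k-1}^*)$ be the increasing rearrangement of $(b_1,\dots,b_{k-2},b_k)$. Then $a_i>b_i^*$ for all $1\le i\le k-1$. -}

module Defs where

open import Data.Nat using (ℕ; suc; _<_)
open import Data.Fin using (Fin; inject₁; fromℕ; punchIn) renaming (_<_ to _<ᶠ_)
open import Data.Product using (Σ; _×_)
open import Relation.Binary.PropositionalEquality using (_≡_)
open import Data.Fin.Permutation using (Permutation′; _⟨$⟩ʳ_)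

StrictlyIncreasing : ∀ {n} → (Fin n → ℕ) → Set
StrictlyIncreasing {n} f = ∀ (i j : Fin n) → i <ᶠ j → f i < f j

-- Index k-1 (1-based) in Fin k, where k = suc (suc m): 0-based index m
idxKm1 : (m : ℕ) → Fin (suc (suc m))
idxKm1 m = inject₁ (fromℕ m)

idxK : (m : ℕ) → Fin (suc (suc m))
idxK m = fromℕ (suc m)

-- The sequence (b_1, …, b_{k-2}, b_k): b with the (k-1)-th entry removed
dropKm1 : (m : ℕ) → (Fin (suc (suc m)) → ℕ) → Fin (suc m) → ℕ
dropKm1 m b i = b (punchIn (idxKm1 m) i)

IsIncreasingRearrangement : ∀ {n} → (Fin n → ℕ) → (Fin n → ℕ) → Set
IsIncreasingRearrangement {n} c bstar =
  Σ (Permutation′ n) (λ σ → (∀ i → bstar i ≡ c (σ ⟨$⟩ʳ i))) × StrictlyIncreasing bstar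

module Submission where

-- Write K = m + 2 and A = a (inject₁ i) for a position i of the
-- rearranged sequence bstar.  The entry bstar i is the (i+1)-th smallest value
-- of the sequence c = (b_1, …, b_{k-2}, b_k), so it suffices to exhibit i+1
-- distinct indices of c whose values lie below A (rank-bound).  They are
--   * the i indices x < i: b x ≤ a x < A, and x ≠ k-1 because i ≤ k-1;
--   * one spare index j ≥ i, j ≠ k-1, with b j < A (spare-index): j = k when
--     i = k-1 (hypothesis b_k < a_{k-1}); otherwise j = i if b_i < a_i, and
--     when a_i = b_i the straddling index, which lies right of i since a_i < a_j.
-- These i+1 indices of Fin K (prefixThen) avoid k-1, so they move injectively
-- into the index set of c through punchOut (punchOut-injection).

open import Defs
open import Data.Nat using (ℕ; suc; _<_; _≤_; _<?_)
open import Data.Nat.Properties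
  using (≤-refl; ≤-antisym; ≤-<-trans; <-≤-trans; <⇒≤; <-trans;
         <-irrefl; <-asym; ≮⇒≥; ≤⇒≯; 1+n≰n; n<1+n; m<1+n⇒m≤n)
open import Data.Fin using (Fin; inject₁; toℕ; fromℕ; fromℕ<; punchIn; punchOut)
  renaming (_<_ to _<ᶠ_; _≟_ to _≟ᶠ_)
open import Data.Fin.Properties
  using (toℕ<n; toℕ≤n; toℕ≤pred[n]; toℕ-injective; toℕ-inject₁; toℕ-fromℕ;
         toℕ-fromℕ<; fromℕ<-injective; fromℕ≢inject₁; <-cmp; injective⇒≤; punchOut-injective; punchIn-punchOut)
open import Data.Fin.Permutation using (_⟨$⟩ʳ_; _⟨$⟩ˡ_; inverseʳ)
open import Data.Product using (Σ; ∃; _×_; _,_; proj₁; proj₂)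
open import Data.Sum using (_⊎_; inj₁; inj₂)
open import Function using (_∘_)
open import Function.Definitions using (Injective)
open import Relation.Binary using (tri<; tri≈; tri>)
open import Relation.Binary.PropositionalEquality
  using (_≡_; _≢_; refl; sym; trans; cong; subst; module ≡-Reasoning)
open import Relation.Nullary using (yes; no; contradiction)

strictlyIncreasing-reflects : ∀ {n} {f : Fin n → ℕ} → StrictlyIncreasing f →
  ∀ {l i} → f l < f i → l <ᶠ i
strictlyIncreasing-reflects increasing {l} {i} fl<fi with <-cmp l i
... | tri< l<i _ _ = l<i
... | tri≈ _ refl _ = contradiction fl<fi (<-irrefl refl)
... | tri> _ _ i<l = contradiction fl<fi (<-asym (increasing i l i<l))

-- Rank bound: if at least i+1 distinct entries of c lie below A, then so does
-- the i-th entry (0-based) of the increasing rearrangement of c.  Otherwise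
-- every entry of bstar below A sits at a position < i, and the positions of
-- the i+1 given entries would inject Fin (i+1) into Fin i.
rank-bound : ∀ {n} {c bstar : Fin n → ℕ} → IsIncreasingRearrangement c bstar →
  (i : Fin n) {A : ℕ} (f : Fin (suc (toℕ i)) → Fin n) →
  Injective _≡_ _≡_ f → (∀ t → c (f t) < A) → bstar i < A
rank-bound {n} {c} {bstar} ((σ , bstar≡c∘σ) , increasing) i {A} f f-injective f<A
  with bstar i <? A
... | yes bstarᵢ<A = bstarᵢ<A
... | no bstarᵢ≮A = contradiction (injective⇒≤ position-injective) 1+n≰n
  where
  position : Fin (suc (toℕ i)) → Fin n
  position t = σ ⟨$⟩ˡ f t

  position<i : ∀ t → position t <ᶠ i
  position<i t = strictlyIncreasing-reflects increasing
    (<-≤-trans (subst (_< A) bstar≡c (f<A t)) (≮⇒≥ bstarᵢ≮A))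
    where
    bstar≡c : c (f t) ≡ bstar (position t)
    bstar≡c = sym (trans (bstar≡c∘σ (position t)) (cong c (inverseʳ σ)))

  position-injective : Injective _≡_ _≡_ (λ t → fromℕ< (position<i t))
  position-injective {t₁} {t₂} eq = f-injective (begin
    f t₁                  ≡⟨ sym (inverseʳ σ) ⟩
    σ ⟨$⟩ʳ position t₁    ≡⟨ cong (σ ⟨$⟩ʳ_) same-position ⟩
    σ ⟨$⟩ʳ position t₂    ≡⟨ inverseʳ σ ⟩
    f t₂                  ∎)
    where
    open ≡-Reasoning
    same-position : position t₁ ≡ position t₂
    same-position = toℕ-injective (fromℕ<-injective _ _ (position<i t₁) (position<i t₂) eq)

prefixThen : ∀ {K} (i' : ℕ) → i' < K → Fin K → Fin (suc i') → Fin K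
prefixThen i' i'<K j t with toℕ t <? i'
... | yes t<i' = fromℕ< (<-trans t<i' i'<K)
... | no _ = j

prefixThen-cases : ∀ {K} (i' : ℕ) (i'<K : i' < K) (j : Fin K) (t : Fin (suc i')) →
  (toℕ t < i' × toℕ (prefixThen i' i'<K j t) ≡ toℕ t) ⊎
  (toℕ t ≡ i' × prefixThen i' i'<K j t ≡ j)
prefixThen-cases i' i'<K j t with toℕ t <? i'
... | yes t<i' = inj₁ (t<i' , toℕ-fromℕ< (<-trans t<i' i'<K))
... | no t≮i' = inj₂ (≤-antisym (m<1+n⇒m≤n (toℕ<n t)) (≮⇒≥ t≮i') , refl)

prefixThen-injective : ∀ {K} (i' : ℕ) (i'<K : i' < K) (j : Fin K) → i' ≤ toℕ j →
  Injective _≡_ _≡_ (prefixThen i' i'<K j)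
prefixThen-injective i' i'<K j i'≤j {t₁} {t₂} eq
  with prefixThen-cases i' i'<K j t₁ | prefixThen-cases i' i'<K j t₂
... | inj₁ (_ , e₁) | inj₁ (_ , e₂) = toℕ-injective (trans (sym e₁) (trans (cong toℕ eq) e₂))
... | inj₁ (t₁<i' , e₁) | inj₂ (_ , e₂) =
  contradiction (subst (_< i') (trans (sym e₁) (cong toℕ (trans eq e₂))) t₁<i') (≤⇒≯ i'≤j)
... | inj₂ (_ , e₁) | inj₁ (t₂<i' , e₂) =
  contradiction (subst (_< i') (trans (sym e₂) (cong toℕ (trans (sym eq) e₁))) t₂<i') (≤⇒≯ i'≤j)
... | inj₂ (q₁ , _) | inj₂ (q₂ , _) = toℕ-injective (trans q₁ (sym q₂))

prefixThen-all : ∀ {K} (i' : ℕ) (i'<K : i' < K) (j : Fin K) (P : Fin K → Set) →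
  (∀ x → toℕ x < i' → P x) → P j → ∀ t → P (prefixThen i' i'<K j t)
prefixThen-all i' i'<K j P below Pj t with prefixThen-cases i' i'<K j t
... | inj₁ (t<i' , e) = below _ (subst (_< i') (sym e) t<i')
... | inj₂ (_ , e) = subst P (sym e) Pj

punchOut-injection : ∀ {n r} (p : Fin (suc n)) (P : Fin (suc n) → Set)
  (g : Fin r → Fin (suc n)) → Injective _≡_ _≡_ g → (∀ t → g t ≢ p × P (g t)) →
  Σ (Fin r → Fin n) λ f → Injective _≡_ _≡_ f × (∀ t → P (punchIn p (f t)))
punchOut-injection p P g g-injective valid =
  (λ t → punchOut (p∉g t)) ,
  (λ eq → g-injective (punchOut-injective (p∉g _) (p∉g _) eq)) ,
  (λ t → subst P (sym (punchIn-punchOut (p∉g t))) (proj₂ (valid t)))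
  where
  p∉g : ∀ t → p ≢ g t
  p∉g t = proj₁ (valid t) ∘ sym

toℕ-idxKm1 : ∀ m → toℕ (idxKm1 m) ≡ m
toℕ-idxKm1 m = trans (toℕ-inject₁ (fromℕ m)) (toℕ-fromℕ m)

module _ (m : ℕ) (a b : Fin (suc (suc m)) → ℕ) (a-increasing : StrictlyIncreasing a)
         (b≤a : ∀ i → b i ≤ a i) where

  prefix-index : (i : Fin (suc m)) (x : Fin (suc (suc m))) → toℕ x < toℕ i →
    x ≢ idxKm1 m × b x < a (inject₁ i)
  prefix-index i x x<i =
    (λ x≡k-1 → ≤⇒≯ (toℕ≤pred[n] i) (subst (_< toℕ i) (trans (cong toℕ x≡k-1) (toℕ-idxKm1 m)) x<i)) ,
    ≤-<-trans (b≤a x) (a-increasing x (inject₁ i) (subst (toℕ x <_) (sym (toℕ-inject₁ i)) x<i))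

  -- Away from k-1, either b_i < a_i, or a_i = b_i and the straddling index
  -- j ≠ k-1 has b_j < a_i < a_j, hence lies to the right of i.
  spare-index-off : (∀ i → a i ≡ b i → ∃ λ j → j ≢ idxKm1 m × b j < a i × a i < a j) →
    (i : Fin (suc (suc m))) → i ≢ idxKm1 m →
    Σ (Fin (suc (suc m))) λ j → toℕ i ≤ toℕ j × j ≢ idxKm1 m × b j < a i
  spare-index-off straddle i i≢k-1 with b i <? a i
  ... | yes bᵢ<aᵢ = i , ≤-refl , i≢k-1 , bᵢ<aᵢ
  ... | no bᵢ≮aᵢ with straddle i (≤-antisym (≮⇒≥ bᵢ≮aᵢ) (b≤a i))
  ...   | j , j≢k-1 , bⱼ<aᵢ , aᵢ<aⱼ =
    j , <⇒≤ (strictlyIncreasing-reflects a-increasing aᵢ<aⱼ) , j≢k-1 , bⱼ<aᵢ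

  -- Every position i of the shortened sequence has a spare index j ≥ i,
  -- j ≠ k-1, with b_j < a_i; at i = k-1 it is k, since b_k < a_{k-1}.
  spare-index : b (idxK m) < a (idxKm1 m) →
    (∀ i → a i ≡ b i → ∃ λ j → j ≢ idxKm1 m × b j < a i × a i < a j) →
    (i : Fin (suc m)) →
    Σ (Fin (suc (suc m))) λ j → toℕ i ≤ toℕ j × j ≢ idxKm1 m × b j < a (inject₁ i)
  spare-index bₖ<aₖ₋₁ straddle i with inject₁ i ≟ᶠ idxKm1 m
  ... | yes i≡k-1 =
    idxK m ,
    subst (toℕ i ≤_) (sym (toℕ-fromℕ (suc m))) (toℕ≤n i) ,
    fromℕ≢inject₁ ,
    subst (λ x → b (idxK m) < a x) (sym i≡k-1) bₖ<aₖ₋₁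
  ... | no i≢k-1 with spare-index-off straddle (inject₁ i) i≢k-1
  ...   | j , i≤j , j≢k-1 , bⱼ<aᵢ = j , subst (_≤ toℕ j) (toℕ-inject₁ i) i≤j , j≢k-1 , bⱼ<aᵢ

  witnesses : b (idxK m) < a (idxKm1 m) →
    (∀ i → a i ≡ b i → ∃ λ j → j ≢ idxKm1 m × b j < a i × a i < a j) →
    (i : Fin (suc m)) →
    Σ (Fin (suc (toℕ i)) → Fin (suc m)) λ f →
      Injective _≡_ _≡_ f × (∀ t → dropKm1 m b (f t) < a (inject₁ i))
  witnesses bₖ<aₖ₋₁ straddle i with spare-index bₖ<aₖ₋₁ straddle i
  ... | j , i≤j , j≢k-1 , bⱼ<aᵢ =
    punchOut-injection (idxKm1 m) (λ x → b x < a (inject₁ i)) (prefixThen (toℕ i) i<K j)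
      (prefixThen-injective (toℕ i) i<K j i≤j)
      (prefixThen-all (toℕ i) i<K j (λ x → x ≢ idxKm1 m × b x < a (inject₁ i))
        (prefix-index i) (j≢k-1 , bⱼ<aᵢ))
    where
    i<K : toℕ i < suc (suc m)
    i<K = <-trans (toℕ<n i) (n<1+n (suc m))

lemma7 : (m : ℕ) → (a b : Fin (suc (suc m)) → ℕ) →
    (∀ i → 0 < a i) → (∀ i → 0 < b i) →
    StrictlyIncreasing a →
    Injective _≡_ _≡_ b →
    (∀ i → b i ≤ a i) →
    b (idxK m) < a (idxKm1 m) →
    (∀ i → a i ≡ b i → ∃ λ j → j ≢ idxKm1 m × b j < a i × a i < a j) →
    (bstar : Fin (suc m) → ℕ) →
    IsIncreasingRearrangement (dropKm1 m b) bstar →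
    ∀ (i : Fin (suc m)) → bstar i < a (inject₁ i)
lemma7 m a b _ _ a-increasing _ b≤a bₖ<aₖ₋₁ straddle bstar rearrangement i
  with witnesses m a b a-increasing b≤a bₖ<aₖ₋₁ straddle i
... | f , f-injective , f<aᵢ = rank-bound {c = dropKm1 m b} rearrangement i f f-injective f<aᵢ
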